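{- Let $G$ be an ordered graph with at least one edge that contains no minedge. Then $sat_{<}(n,G)=\Theta(n)$.
   Context: An ordered graph is a finite simple graph whose vertex set is linearly ordered. $H$ contains $G$ if there is an injective order-preserving map $\varphi:V(G)\to V(H)$ with $\varphi(u)\varphi(v)\in E(H)$ for all $uv\in E(G)$; otherwise $H$ avoids $G$. $H$ saturates $G$ if $H$ avoids $G$ but adding any non-edge to $H$ yields a graph containing $G$. $sat_{<}(n,G)$ is the minimum number of edges of an ordered graph on $n$ vertices saturating $G$. An edge $uv$ ($u<v$) is a minedge if no vertex lies strictly between $u$ and $v$ and both $u,v$ have degree one. -}

module Defs where

open import Data.Nat using (ℕ; zero; suc; _+_; _*_; _≤_; _<_; _<ᵇ_)
open import Data.Bool using (Bool; true; false; _∧_; _∨_; if_then_else_)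
open import Data.Fin using (Fin; toℕ; _≟_)
open import Data.List using (List; map; allFin)
open import Data.Nat.ListAction using (sum)
open import Data.Product using (Σ; _×_; ∃; ∃-syntax)
open import Relation.Nullary using (¬_; does)
open import Relation.Binary.PropositionalEquality using (_≡_)

-- The graph is represented by a Boolean function E on
-- pairs; only the values E i j with i < j are meaningful (E i j = true
-- means that i j is an edge).  This makes every such E a simple graph
-- (no loops, undirected), with no side conditions needed.
OGraph : ℕ → Set
OGraph n = Fin n → Fin n → Bool

adj : ∀ {n} → OGraph n → Fin n → Fin n → Bool
adj E u v =
  if toℕ u <ᵇ toℕ v then E u v
  else (if toℕ v <ᵇ toℕ u then E v u else false)

bit : Bool → ℕ
bit true  = 1
bit false = 0

edges : ∀ {n} → OGraph n → ℕ
edges {n} E =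
  sum (map (λ i → sum (map (λ j → bit ((toℕ i <ᵇ toℕ j) ∧ E i j)) (allFin n))) (allFin n))

degree : ∀ {n} → OGraph n → Fin n → ℕ
degree {n} E v = sum (map (λ w → bit (adj E v w)) (allFin n))

Contains : ∀ {n k} → OGraph n → OGraph k → Set
Contains {n} {k} H G =
  Σ (Fin k → Fin n) λ φ →
    (∀ u v → toℕ u < toℕ v → toℕ (φ u) < toℕ (φ v)) ×
    (∀ u v → adj G u v ≡ true → adj H (φ u) (φ v) ≡ true)

addEdge : ∀ {n} → OGraph n → Fin n → Fin n → OGraph n
addEdge E u v x y = E x y ∨ (does (x ≟ u) ∧ does (y ≟ v))

Saturates : ∀ {n k} → OGraph n → OGraph k → Set
Saturates {n} H G =
  ¬ Contains H G ×
  (∀ (u v : Fin n) → toℕ u < toℕ v → H u v ≡ false → Contains (addEdge H u v) G)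

IsSat : ∀ {k} → ℕ → OGraph k → ℕ → Set
IsSat n G m =
  (Σ (OGraph n) λ H → Saturates H G × edges H ≡ m) ×
  (∀ (H : OGraph n) → Saturates H G → m ≤ edges H)

IsMinedge : ∀ {k} → OGraph k → Fin k → Fin k → Set
IsMinedge G u v =
  toℕ v ≡ suc (toℕ u) × G u v ≡ true × degree G u ≡ 1 × degree G v ≡ 1

HasEdge : ∀ {k} → OGraph k → Set
HasEdge {k} G = ∃[ u ] ∃[ v ] (toℕ u < toℕ v × G u v ≡ true)

-- Lower bound: if two consecutive vertices x, x + 1 of a G-saturated graph H were both isolated,
-- adding the edge x (x + 1) would create a copy of G that uses the new edge; the preimage of that
-- edge joins two consecutive vertices of G, each of degree one, i.e. it is a minedge. So of any
-- two consecutive vertices one has positive degree, and n ≤ 2 Σ deg + 1 ≤ 4 e(H) + 1.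
--
-- Upper bound: let a be the last vertex of G with a neighbour to its right, at position A.
-- Joining each of the first A vertices to every later vertex gives a G-free graph (any copy
-- puts a at a position ≥ A), which extends to a G-saturated graph H. In H a vertex x at position
-- ≥ A has fewer than k - A - 1 right neighbours: otherwise the first A vertices, x and those
-- neighbours carry a copy of G. Hence e(H) ≤ A n + n k ≤ 2 k n.
--
-- Saturated graphs, and one with the fewest edges, exist by exhaustive search over the finitely
-- many ordered graphs on n vertices.

module Submission where

open import Data.Bool.Base using (Bool; true; false; _∧_; _∨_; T; if_then_else_)
import Data.Bool.Properties as Bool
open import Data.Empty using (⊥; ⊥-elim)
open import Data.Fin.Base using (Fin; zero; suc; toℕ; fromℕ<; inject₁; finToFun; funToFin)
import Data.Fin.Properties as Fin
open import Data.List.Base using (map; allFin; tabulate)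
open import Data.List.Properties using (map-tabulate)
import Data.Nat.ListAction as ListAction
open import Data.Nat.Base
open import Data.Nat.Properties
open import Data.Nat.Tactic.RingSolver using (solve-∀)
open import Data.Product.Base using (Σ; ∃; ∃-syntax; ∃₂; _×_; _,_; proj₁; proj₂; swap)
open import Data.Sum.Base as Sum using (_⊎_; inj₁; inj₂)
open import Data.Vec.Functional using (_∷_)
open import Function.Base using (_∘_; id)
open import Function.Bundles using (Inverse)
open import Relation.Binary.Definitions using (tri<; tri≈; tri>)
open import Relation.Binary.PropositionalEquality
open import Relation.Nullary.Decidable
  using (Dec; yes; no; does; map′; _×-dec_; _→-dec_; ¬?; dec-true)
open import Relation.Nullary.Negation using (¬_; contradiction)
open import Relation.Unary using (Decidable)
open import Algebra.Properties.CommutativeMonoid.Sum +-0-commutativeMonoid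
  using (sum; sum-syntax; ∑-comm; ∑-distrib-+; sum-cong-≗)

open import Defs

sum-tabulate : ∀ {n} (f : Fin n → ℕ) → ListAction.sum (tabulate f) ≡ sum f
sum-tabulate {zero}  f = refl
sum-tabulate {suc n} f = cong (f zero +_) (sum-tabulate (f ∘ suc))

sum-allFin : ∀ n (f : Fin n → ℕ) → ListAction.sum (map f (allFin n)) ≡ sum f
sum-allFin n f = trans (cong ListAction.sum (map-tabulate id f)) (sum-tabulate f)

sum-mono-≤ : ∀ {n} {f g : Fin n → ℕ} → (∀ i → f i ≤ g i) → sum f ≤ sum g
sum-mono-≤ {zero}  f≤g = z≤n
sum-mono-≤ {suc n} f≤g = +-mono-≤ (f≤g zero) (sum-mono-≤ (f≤g ∘ suc))

sum-mono-< : ∀ {n} {f g : Fin n → ℕ} → (∀ i → f i ≤ g i) → ∀ i → f i < g i → sum f < sum g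
sum-mono-< f≤g zero    fi<gi = +-mono-<-≤ fi<gi (sum-mono-≤ (f≤g ∘ suc))
sum-mono-< f≤g (suc i) fi<gi = +-mono-≤-< (f≤g zero) (sum-mono-< (f≤g ∘ suc) i fi<gi)

≤-sum : ∀ {n} (f : Fin n → ℕ) i → f i ≤ sum f
≤-sum f zero    = m≤m+n (f zero) _
≤-sum f (suc i) = ≤-trans (≤-sum (f ∘ suc) i) (m≤n+m _ (f zero))

sum-≤-const : ∀ {n c} {f : Fin n → ℕ} → (∀ i → f i ≤ c) → sum f ≤ n * c
sum-≤-const {zero}  f≤c = z≤n
sum-≤-const {suc n} f≤c = +-mono-≤ (f≤c zero) (sum-≤-const (f≤c ∘ suc))

sum-≤-split : ∀ {n} a {c d} {f : Fin n → ℕ} →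
  (∀ i → toℕ i < a → f i ≤ c) → (∀ i → a ≤ toℕ i → f i ≤ d) → sum f ≤ a * c + n * d
sum-≤-split {zero}  a       f≤c f≤d = z≤n
sum-≤-split {suc n} zero    f≤c f≤d = sum-≤-const (λ i → f≤d i z≤n)
sum-≤-split {suc n} (suc a) {c} {d} {f} f≤c f≤d = begin
  f zero + sum (f ∘ suc)   ≤⟨ +-mono-≤ (f≤c zero z<s)
                                (sum-≤-split a (λ i → f≤c (suc i) ∘ s<s) (λ i → f≤d (suc i) ∘ s≤s)) ⟩
  c + (a * c + n * d)      ≡⟨ +-assoc c (a * c) (n * d) ⟨
  c + a * c + n * d        ≤⟨ +-monoʳ-≤ (c + a * c) (m≤n+m (n * d) d) ⟩
  c + a * c + (d + n * d)  ∎
  where open ≤-Reasoning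

n≤2*sum+1 : ∀ n (f : Fin n → ℕ) → (∀ x y → toℕ y ≡ suc (toℕ x) → 1 ≤ f x + f y) →
  n ≤ 2 * sum f + 1
n≤2*sum+1 zero          f pos = z≤n
n≤2*sum+1 (suc zero)    f pos = m≤n+m 1 _
n≤2*sum+1 (suc (suc n)) f pos = begin
  2 + n                                ≤⟨ +-mono-≤ (*-monoʳ-≤ 2 (pos zero (suc zero) refl)) rest ⟩
  2 * (f₀ + f₁) + (2 * sum f₂ + 1)     ≡⟨ regroup f₀ f₁ (sum f₂) ⟩
  2 * (f₀ + (f₁ + sum f₂)) + 1         ∎
  where
  open ≤-Reasoning
  f₀ f₁ : ℕ
  f₀ = f zero
  f₁ = f (suc zero)
  f₂ : Fin n → ℕ
  f₂ i = f (suc (suc i))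
  rest : n ≤ 2 * sum f₂ + 1
  rest = n≤2*sum+1 n f₂ (λ x y y≡1+x → pos (suc (suc x)) (suc (suc y)) (cong (2 +_) y≡1+x))
  regroup : ∀ p q r → 2 * (p + q) + (2 * r + 1) ≡ 2 * (p + (q + r)) + 1
  regroup = solve-∀

count : ∀ {n} → (Fin n → Bool) → ℕ
count {n} b = ∑[ i < n ] bit (b i)

count-≤ : ∀ {n} (b : Fin n → Bool) → count b ≤ n
count-≤ {n} b = subst (count b ≤_) (*-identityʳ n) (sum-≤-const (bit≤1 ∘ b))
  where
  bit≤1 : ∀ x → bit x ≤ 1
  bit≤1 true  = ≤-refl
  bit≤1 false = z≤n

count-none : ∀ {n} (b : Fin n → Bool) → (∀ i → b i ≢ true) → count b ≡ 0
count-none {zero}  b none = refl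
count-none {suc n} b none rewrite Bool.¬-not (none zero) = count-none (b ∘ suc) (none ∘ suc)

count-unique : ∀ {n} (b : Fin n → Bool) v → b v ≡ true → (∀ w → b w ≡ true → w ≡ v) → count b ≡ 1
count-unique b zero    bv unique rewrite bv =
  cong suc (count-none (b ∘ suc) (λ i bi → Fin.0≢1+n (sym (unique (suc i) bi))))
count-unique b (suc v) bv unique rewrite Bool.¬-not (Fin.0≢1+n ∘ unique zero) =
  count-unique (b ∘ suc) v bv (λ w bw → Fin.suc-injective (unique (suc w) bw))

module _ {P : ℕ → Set} (P? : Decidable P) where

  least : ∀ b → ∃[ j ] j ≤ b × P j → ∃[ m ] P m × (∀ {j} → P j → m ≤ j)
  least zero    (j , j≤0 , pj) = 0 , subst P (n≤0⇒n≡0 j≤0) pj , λ _ → z≤n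
  least (suc b) (j , j≤1+b , pj) with anyUpTo? P? (suc b)
  ... | yes (i , i<1+b , pi) = least b (i , s≤s⁻¹ i<1+b , pi)
  ... | no none = suc b , subst P (≤∧≮⇒≡ j≤1+b (λ j<1+b → none (j , j<1+b , pj))) pj ,
                  λ {i} pi → ≮⇒≥ (λ i<1+b → none (i , i<1+b , pi))

  greatest : ∀ b → (∀ {j} → P j → j ≤ b) → ∃ P → ∃[ m ] P m × (∀ {j} → P j → j ≤ m)
  greatest zero    bounded (e , pe) = 0 , subst P (n≤0⇒n≡0 (bounded pe)) pe , bounded
  greatest (suc b) bounded pe with P? (suc b)
  ... | yes pb = suc b , pb , bounded
  ... | no ¬pb = greatest b (λ pj → m<1+n⇒m≤n (≤∧≢⇒< (bounded pj) (λ { refl → ¬pb pj }))) pe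

greatest-Fin : ∀ {n} {P : Fin n → Set} → Decidable P → ∃ P →
  ∃[ a ] P a × (∀ u → toℕ a < toℕ u → ¬ P u)
greatest-Fin {n} {P} P? (e , pe)
  with greatest Q? n (λ (u , u≡j , _) → subst (_≤ n) u≡j (<⇒≤ (Fin.toℕ<n u))) (toℕ e , e , refl , pe)
  where
  Q : ℕ → Set
  Q j = ∃[ u ] toℕ u ≡ j × P u
  Q? : Decidable Q
  Q? j = Fin.any? (λ u → (toℕ u ≟ j) ×-dec P? u)
... | _ , (a , refl , pa) , maximal = a , pa , λ u a<u pu → <⇒≱ a<u (maximal (u , refl , pu))

<⇒<ᵇ≡true : ∀ {m n} → m < n → (m <ᵇ n) ≡ true
<⇒<ᵇ≡true {m} {n} m<n with m <ᵇ n | <⇒<ᵇ m<n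
... | true | _ = refl

<ᵇ≡true⇒< : ∀ {m n} → (m <ᵇ n) ≡ true → m < n
<ᵇ≡true⇒< {m} {n} m<ᵇn = <ᵇ⇒< m n (subst T (sym m<ᵇn) _)

≮⇒<ᵇ≡false : ∀ {m n} → ¬ m < n → (m <ᵇ n) ≡ false
≮⇒<ᵇ≡false m≮n = Bool.¬-not (m≮n ∘ <ᵇ≡true⇒<)

_≐_ : ∀ {n} → OGraph n → OGraph n → Set
H ≐ H′ = ∀ i j → H i j ≡ H′ i j

_⊆_ : ∀ {n} → OGraph n → OGraph n → Set
H ⊆ H′ = ∀ i j → toℕ i < toℕ j → H i j ≡ true → H′ i j ≡ true

Increasing : ∀ {k n} → (Fin k → Fin n) → Set
Increasing φ = ∀ u v → toℕ u < toℕ v → toℕ (φ u) < toℕ (φ v)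

Homomorphism : ∀ {k n} → OGraph k → OGraph n → (Fin k → Fin n) → Set
Homomorphism G H φ = ∀ u v → adj G u v ≡ true → adj H (φ u) (φ v) ≡ true

Isolated : ∀ {n} → OGraph n → Fin n → Set
Isolated H x = ∀ w → adj H x w ≡ false

HasRightNeighbour : ∀ {n} → OGraph n → Fin n → Set
HasRightNeighbour H u = ∃[ v ] toℕ u < toℕ v × H u v ≡ true

rightDegree : ∀ {n} → OGraph n → Fin n → ℕ
rightDegree H i = count (λ j → (toℕ i <ᵇ toℕ j) ∧ H i j)

module _ {n} (H : OGraph n) where

  adj-< : ∀ x y → toℕ x < toℕ y → adj H x y ≡ H x y
  adj-< x y x<y rewrite <⇒<ᵇ≡true x<y = refl

  adj-> : ∀ x y → toℕ y < toℕ x → adj H x y ≡ H y x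
  adj-> x y y<x rewrite ≮⇒<ᵇ≡false (<⇒≯ y<x) | <⇒<ᵇ≡true y<x = refl

  adj-≡ : ∀ x y → toℕ x ≡ toℕ y → adj H x y ≡ false
  adj-≡ x y x≡y rewrite x≡y | ≮⇒<ᵇ≡false (n≮n (toℕ y)) = refl

  adj-sym : ∀ x y → adj H x y ≡ adj H y x
  adj-sym x y with <-cmp (toℕ x) (toℕ y)
  ... | tri< x<y _ _   = trans (adj-< x y x<y) (sym (adj-> y x x<y))
  ... | tri≈ _ x≡y _   = trans (adj-≡ x y x≡y) (sym (adj-≡ y x (sym x≡y)))
  ... | tri> _ _ y<x   = trans (adj-> x y y<x) (sym (adj-< y x y<x))

  degree≡count : ∀ x → degree H x ≡ count (adj H x)
  degree≡count x = sum-allFin n _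

  edges≡∑rightDegree : edges H ≡ ∑[ i < n ] rightDegree H i
  edges≡∑rightDegree =
    trans (sum-allFin n _) (sum-cong-≗ λ i → sum-allFin n (λ j → bit ((toℕ i <ᵇ toℕ j) ∧ H i j)))

  degree≡0⇒isolated : ∀ x → degree H x ≡ 0 → Isolated H x
  degree≡0⇒isolated x deg≡0 w = Bool.¬-not λ xw → 1+n≰n (begin
    1                         ≡⟨ cong bit xw ⟨
    bit (adj H x w)           ≤⟨ ≤-sum (bit ∘ adj H x) w ⟩
    count (adj H x)           ≡⟨ degree≡count x ⟨
    degree H x                ≡⟨ deg≡0 ⟩
    0                         ∎)
    where open ≤-Reasoning

  ∑degree≤2*edges : ∑[ x < n ] degree H x ≤ 2 * edges H
  ∑degree≤2*edges = begin
    ∑[ x < n ] degree H x                                 ≡⟨ sum-cong-≗ degree≡count ⟩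
    ∑[ x < n ] count (adj H x)                            ≤⟨ sum-mono-≤ (λ x → sum-mono-≤ (adj≤ x)) ⟩
    ∑[ x < n ] ∑[ w < n ] (e x w + e w x)
      ≡⟨ sum-cong-≗ (λ x → ∑-distrib-+ (e x) (λ w → e w x)) ⟩
    ∑[ x < n ] (∑[ w < n ] e x w + ∑[ w < n ] e w x)      ≡⟨ ∑-distrib-+ (λ x → ∑[ w < n ] e x w) _ ⟩
    ∑[ x < n ] ∑[ w < n ] e x w + ∑[ x < n ] ∑[ w < n ] e w x
      ≡⟨ cong (edges′ +_) (∑-comm (λ x w → e w x)) ⟩
    edges′ + edges′                                       ≡⟨ cong (λ m → m + m) edges≡∑rightDegree ⟨
    edges H + edges H                                     ≡⟨ cong (edges H +_) (+-identityʳ (edges H)) ⟨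
    2 * edges H                                           ∎
    where
    open ≤-Reasoning
    e : Fin n → Fin n → ℕ
    e i j = bit ((toℕ i <ᵇ toℕ j) ∧ H i j)
    edges′ : ℕ
    edges′ = ∑[ i < n ] rightDegree H i
    adj≤ : ∀ x w → bit (adj H x w) ≤ e x w + e w x
    adj≤ x w with <-cmp (toℕ x) (toℕ w)
    ... | tri< x<w _ _ rewrite adj-< x w x<w | <⇒<ᵇ≡true x<w = m≤m+n _ _
    ... | tri≈ _ x≡w _ rewrite adj-≡ x w x≡w = z≤n
    ... | tri> _ _ w<x rewrite adj-> x w w<x | <⇒<ᵇ≡true w<x = m≤n+m _ _

module _ {n} {H H′ : OGraph n} (H≐H′ : H ≐ H′) where

  adj-cong : ∀ x y → adj H x y ≡ adj H′ x y
  adj-cong x y = cong₂ (λ b b′ → if toℕ x <ᵇ toℕ y then b else (if toℕ y <ᵇ toℕ x then b′ else false))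
    (H≐H′ x y) (H≐H′ y x)

  edges-cong : edges H ≡ edges H′
  edges-cong = begin
    edges H                                  ≡⟨ edges≡∑rightDegree H ⟩
    ∑[ i < n ] rightDegree H i
      ≡⟨ sum-cong-≗ (λ i → sum-cong-≗ (λ j → cong (λ b → bit ((toℕ i <ᵇ toℕ j) ∧ b)) (H≐H′ i j))) ⟩
    ∑[ i < n ] rightDegree H′ i              ≡⟨ edges≡∑rightDegree H′ ⟨
    edges H′                                 ∎
    where open ≡-Reasoning

  Contains-resp : ∀ {k} {G : OGraph k} → Contains H G → Contains H′ G
  Contains-resp (φ , φ-inc , φ-hom) = φ , φ-inc , λ u v uv → trans (sym (adj-cong (φ u) (φ v))) (φ-hom u v uv)

  addEdge-cong : ∀ u v → addEdge H u v ≐ addEdge H′ u v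
  addEdge-cong u v i j = cong (_∨ _) (H≐H′ i j)

≐-sym : ∀ {n} {H H′ : OGraph n} → H ≐ H′ → H′ ≐ H
≐-sym H≐H′ i j = sym (H≐H′ i j)

Saturates-resp : ∀ {n k} {H H′ : OGraph n} {G : OGraph k} → H ≐ H′ → Saturates H G → Saturates H′ G
Saturates-resp H≐H′ (free , saturated) =
  free ∘ Contains-resp (≐-sym H≐H′) ,
  λ u v u<v H′uv → Contains-resp (addEdge-cong H≐H′ u v) (saturated u v u<v (trans (H≐H′ u v) H′uv))

∨-does-∧ : ∀ {A B : Set} b (A? : Dec A) (B? : Dec B) → (b ∨ (does A? ∧ does B?)) ≡ true →
  b ≡ true ⊎ A × B
∨-does-∧ true  _       _       _ = inj₁ refl
∨-does-∧ false (yes a) (yes b) _ = inj₂ (a , b)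
∨-does-∧ false (no _)  _       ()
∨-does-∧ false (yes _) (no _)  ()

addEdge-true : ∀ {n} (H : OGraph n) x y p q → addEdge H x y p q ≡ true → H p q ≡ true ⊎ (p ≡ x × q ≡ y)
addEdge-true H x y p q = ∨-does-∧ (H p q) (p Fin.≟ x) (q Fin.≟ y)

adj-addEdge : ∀ {n} (H : OGraph n) x y p q → adj (addEdge H x y) p q ≡ true →
  adj H p q ≡ true ⊎ (p ≡ x × q ≡ y) ⊎ (p ≡ y × q ≡ x)
adj-addEdge H x y p q added with <-cmp (toℕ p) (toℕ q)
... | tri≈ _ p≡q _ = contradiction (trans (sym (adj-≡ (addEdge H x y) p q p≡q)) added) λ ()
... | tri< p<q _ _ = Sum.map (trans (adj-< H p q p<q)) inj₁
  (addEdge-true H x y p q (trans (sym (adj-< (addEdge H x y) p q p<q)) added))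
... | tri> _ _ q<p = Sum.map (trans (adj-> H p q q<p)) (inj₂ ∘ swap)
  (addEdge-true H x y q p (trans (sym (adj-> (addEdge H x y) p q q<p)) added))

isolated-addEdge : ∀ {n} (H : OGraph n) x y {p z} → Isolated H p → adj (addEdge H x y) p z ≡ true →
  (p ≡ x × z ≡ y) ⊎ (p ≡ y × z ≡ x)
isolated-addEdge H x y {p} {z} p-isolated added with adj-addEdge H x y p z added
... | inj₁ old = contradiction (trans (sym (p-isolated z)) old) λ ()
... | inj₂ new = new

⊆-addEdge : ∀ {n} (H : OGraph n) u v → H ⊆ addEdge H u v
⊆-addEdge H u v i j _ Hij rewrite Hij = refl

edges-addEdge : ∀ {n} (H : OGraph n) u v → toℕ u < toℕ v → H u v ≡ false → edges H < edges (addEdge H u v)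
edges-addEdge {n} H u v u<v Huv≡false = begin-strict
  edges H                                      ≡⟨ edges≡∑rightDegree H ⟩
  ∑[ i < n ] rightDegree H i                   <⟨ sum-mono-< (λ i → sum-mono-≤ (bit-mono i)) u
                                                    (sum-mono-< (bit-mono u) v at-uv) ⟩
  ∑[ i < n ] rightDegree (addEdge H u v) i     ≡⟨ edges≡∑rightDegree (addEdge H u v) ⟨
  edges (addEdge H u v)                        ∎
  where
  open ≤-Reasoning
  bit-mono : ∀ i j → bit ((toℕ i <ᵇ toℕ j) ∧ H i j) ≤ bit ((toℕ i <ᵇ toℕ j) ∧ addEdge H u v i j)
  bit-mono i j with toℕ i <ᵇ toℕ j | H i j
  ... | false | _    = z≤n
  ... | true  | true = ≤-refl
  ... | true  | false = z≤n
  at-uv : bit ((toℕ u <ᵇ toℕ v) ∧ H u v) < bit ((toℕ u <ᵇ toℕ v) ∧ addEdge H u v u v)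
  at-uv rewrite <⇒<ᵇ≡true u<v | Huv≡false | dec-true (u Fin.≟ u) refl | dec-true (v Fin.≟ v) refl = z<s

edges≤n² : ∀ {n} (H : OGraph n) → edges H ≤ n * n
edges≤n² {n} H =
  subst (_≤ n * n) (sym (edges≡∑rightDegree H)) (sum-≤-const {f = rightDegree H} (λ i → count-≤ _))

⊆-trans : ∀ {n} {H H′ H″ : OGraph n} → H ⊆ H′ → H′ ⊆ H″ → H ⊆ H″
⊆-trans H⊆H′ H′⊆H″ i j i<j = H′⊆H″ i j i<j ∘ H⊆H′ i j i<j

module _ {k n} {φ : Fin k → Fin n} (φ-inc : Increasing φ) where

  Increasing-reflects-< : ∀ {u v} → toℕ (φ u) < toℕ (φ v) → toℕ u < toℕ v
  Increasing-reflects-< {u} {v} φu<φv with <-cmp (toℕ u) (toℕ v)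
  ... | tri< u<v _ _ = u<v
  ... | tri≈ _ u≡v _ = contradiction (cong (toℕ ∘ φ) (Fin.toℕ-injective u≡v)) (<⇒≢ φu<φv)
  ... | tri> _ _ v<u = contradiction (φ-inc v u v<u) (<⇒≯ φu<φv)

  Increasing-injective : ∀ {u v} → φ u ≡ φ v → u ≡ v
  Increasing-injective {u} {v} φu≡φv with <-cmp (toℕ u) (toℕ v)
  ... | tri< u<v _ _ = contradiction (cong toℕ φu≡φv) (<⇒≢ (φ-inc u v u<v))
  ... | tri≈ _ u≡v _ = Fin.toℕ-injective u≡v
  ... | tri> _ _ v<u = contradiction (cong toℕ (sym φu≡φv)) (<⇒≢ (φ-inc v u v<u))

  Increasing-reflects-consecutive : ∀ {u v} → toℕ (φ v) ≡ suc (toℕ (φ u)) → toℕ v ≡ suc (toℕ u)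
  Increasing-reflects-consecutive {u} {v} φv≡1+φu
    with m≤n⇒m<n∨m≡n (Increasing-reflects-< (≤-reflexive (sym φv≡1+φu)))
  ... | inj₂ 1+u≡v = sym 1+u≡v
  ... | inj₁ 1+u<v =
    contradiction (s≤s⁻¹ (subst (toℕ (φ w) <_) φv≡1+φu (φ-inc w v w<v))) (<⇒≱ (φ-inc u w u<w))
    where
    w : Fin k
    w = fromℕ< (<-trans 1+u<v (Fin.toℕ<n v))
    u<w : toℕ u < toℕ w
    u<w = ≤-reflexive (sym (Fin.toℕ-fromℕ< _))
    w<v : toℕ w < toℕ v
    w<v = subst (_< toℕ v) (sym (Fin.toℕ-fromℕ< _)) 1+u<v

Increasing-≥ : ∀ {k n} {φ : Fin k → Fin n} → Increasing φ → ∀ u → toℕ u ≤ toℕ (φ u)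
Increasing-≥ φ-inc zero    = z≤n
Increasing-≥ {φ = φ} φ-inc (suc u) = begin-strict
  toℕ u                     ≤⟨ Increasing-≥ φ∘inject₁-inc u ⟩
  toℕ (φ (inject₁ u))       <⟨ φ-inc (inject₁ u) (suc u) (s≤s (≤-reflexive (Fin.toℕ-inject₁ u))) ⟩
  toℕ (φ (suc u))           ∎
  where
  open ≤-Reasoning
  φ∘inject₁-inc : Increasing (φ ∘ inject₁)
  φ∘inject₁-inc s t s<t =
    φ-inc (inject₁ s) (inject₁ t) (subst₂ _<_ (sym (Fin.toℕ-inject₁ s)) (sym (Fin.toℕ-inject₁ t)) s<t)

homomorphism-from-< : ∀ {k n} {G : OGraph k} {H : OGraph n} {φ : Fin k → Fin n} → Increasing φ →
  (∀ u v → toℕ u < toℕ v → G u v ≡ true → H (φ u) (φ v) ≡ true) → Homomorphism G H φ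
homomorphism-from-< {G = G} {H} {φ} φ-inc forward u v uv with <-cmp (toℕ u) (toℕ v)
... | tri< u<v _ _ = trans (adj-< H (φ u) (φ v) (φ-inc u v u<v)) (forward u v u<v (trans (sym (adj-< G u v u<v)) uv))
... | tri≈ _ u≡v _ = contradiction (trans (sym (adj-≡ G u v u≡v)) uv) λ ()
... | tri> _ _ v<u = trans (adj-> H (φ u) (φ v) (φ-inc v u v<u)) (forward v u v<u (trans (sym (adj-> G u v v<u)) uv))

-- Deciding containment and saturation

-- Without function extensionality, P must respect ≗ for the enumeration of Fin (n ^ k) via
-- finToFun to meet every φ.
∃-function? : ∀ {k n} {P : (Fin k → Fin n) → Set} → (∀ {φ ψ} → φ ≗ ψ → P φ → P ψ) →
  Decidable P → Dec (∃ P)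
∃-function? resp P? = map′
  (λ (i , p) → finToFun i , p)
  (λ (φ , p) → funToFin φ , resp (sym ∘ Fin.finToFun-funToFin φ) p)
  (Fin.any? (P? ∘ finToFun))

decodeGraph : ∀ {n} → (Fin n → Fin (2 ^ n)) → OGraph n
decodeGraph c i j = Inverse.to Fin.2↔Bool (finToFun (c i) j)

encodeGraph : ∀ {n} → OGraph n → Fin n → Fin (2 ^ n)
encodeGraph H i = funToFin (Inverse.from Fin.2↔Bool ∘ H i)

decode-encode : ∀ {n} (H : OGraph n) → decodeGraph (encodeGraph H) ≐ H
decode-encode H i j = trans
  (cong (Inverse.to Fin.2↔Bool) (Fin.finToFun-funToFin (Inverse.from Fin.2↔Bool ∘ H i) j))
  (Inverse.strictlyInverseˡ Fin.2↔Bool (H i j))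

∃-graph? : ∀ {n} {P : OGraph n → Set} → (∀ {H H′} → H ≐ H′ → P H → P H′) →
  Decidable P → Dec (∃ P)
∃-graph? {P = P} resp P? = map′
  (λ (c , p) → decodeGraph c , p)
  (λ (H , p) → encodeGraph H , resp (λ i j → sym (decode-encode H i j)) p)
  (∃-function? {P = P ∘ decodeGraph}
    (λ c≗c′ → resp (λ i j → cong (λ c → Inverse.to Fin.2↔Bool (finToFun c j)) (c≗c′ i)))
    (P? ∘ decodeGraph))

Increasing? : ∀ {k n} (φ : Fin k → Fin n) → Dec (Increasing φ)
Increasing? φ = Fin.all? λ u → Fin.all? λ v → (toℕ u <? toℕ v) →-dec (toℕ (φ u) <? toℕ (φ v))

Homomorphism? : ∀ {k n} (G : OGraph k) (H : OGraph n) φ → Dec (Homomorphism G H φ)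
Homomorphism? G H φ = Fin.all? λ u → Fin.all? λ v →
  (adj G u v Bool.≟ true) →-dec (adj H (φ u) (φ v) Bool.≟ true)

Contains? : ∀ {n k} (H : OGraph n) (G : OGraph k) → Dec (Contains H G)
Contains? H G = ∃-function? respects (λ φ → Increasing? φ ×-dec Homomorphism? G H φ)
  where
  respects : ∀ {φ ψ} → φ ≗ ψ → Increasing φ × Homomorphism G H φ → Increasing ψ × Homomorphism G H ψ
  respects φ≗ψ (φ-inc , φ-hom) =
    (λ u v u<v → subst₂ (λ x y → toℕ x < toℕ y) (φ≗ψ u) (φ≗ψ v) (φ-inc u v u<v)) ,
    (λ u v uv → subst₂ (λ x y → adj H x y ≡ true) (φ≗ψ u) (φ≗ψ v) (φ-hom u v uv))

Saturates? : ∀ {n k} (H : OGraph n) (G : OGraph k) → Dec (Saturates H G)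
Saturates? H G = ¬? (Contains? H G) ×-dec Fin.all? λ u → Fin.all? λ v →
  (toℕ u <? toℕ v) →-dec ((H u v Bool.≟ false) →-dec Contains? (addEdge H u v) G)

_⊆?_ : ∀ {n} (H H′ : OGraph n) → Dec (H ⊆ H′)
H ⊆? H′ = Fin.all? λ i → Fin.all? λ j →
  (toℕ i <? toℕ j) →-dec ((H i j Bool.≟ true) →-dec (H′ i j Bool.≟ true))

saturating-extension : ∀ {n k} {G : OGraph k} {H : OGraph n} → ¬ Contains H G →
  ∃[ H′ ] H ⊆ H′ × Saturates H′ G
saturating-extension {n} {G = G} {H} H-free
  with greatest Q? (n * n) (λ (H′ , _ , edges≡j) → subst (_≤ n * n) edges≡j (edges≤n² H′))
                 (edges H , H , ((λ _ _ _ → id) , H-free) , refl)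
  where
  Q : ℕ → Set
  Q m = ∃[ H′ ] (H ⊆ H′ × ¬ Contains H′ G) × edges H′ ≡ m
  respects : ∀ {m H′ H″} → H′ ≐ H″ → (H ⊆ H′ × ¬ Contains H′ G) × edges H′ ≡ m →
    (H ⊆ H″ × ¬ Contains H″ G) × edges H″ ≡ m
  respects H′≐H″ ((H⊆H′ , H′-free) , edges≡m) =
    ((λ i j i<j → trans (sym (H′≐H″ i j)) ∘ H⊆H′ i j i<j) ,
     H′-free ∘ Contains-resp (≐-sym H′≐H″)) ,
    trans (sym (edges-cong H′≐H″)) edges≡m
  Q? : Decidable Q
  Q? m = ∃-graph? respects λ H′ → ((H ⊆? H′) ×-dec ¬? (Contains? H′ G)) ×-dec (edges H′ ≟ m)
... | _ , (H′ , (H⊆H′ , H′-free) , refl) , maximal = H′ , H⊆H′ , H′-free , saturated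
  where
  saturated : ∀ u v → toℕ u < toℕ v → H′ u v ≡ false → Contains (addEdge H′ u v) G
  saturated u v u<v H′uv with Contains? (addEdge H′ u v) G
  ... | yes contains = contains
  ... | no  free     = contradiction
    (maximal (addEdge H′ u v , (⊆-trans H⊆H′ (⊆-addEdge H′ u v) , free) , refl))
    (<⇒≱ (edges-addEdge H′ u v u<v H′uv))

sat-attained : ∀ {n k} {G : OGraph k} {H : OGraph n} → Saturates H G →
  ∃[ m ] IsSat n G m × m ≤ edges H
sat-attained {n} {G = G} {H} H-sat with least P? (edges H) (edges H , ≤-refl , H , H-sat , refl)
  where
  P : ℕ → Set
  P m = ∃[ H′ ] Saturates H′ G × edges H′ ≡ m
  P? : Decidable P
  P? m = ∃-graph?
    (λ H′≐H″ (H′-sat , edges≡m) → Saturates-resp H′≐H″ H′-sat , trans (sym (edges-cong H′≐H″)) edges≡m)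
    (λ H′ → Saturates? H′ G ×-dec (edges H′ ≟ m))
... | m , attained , minimal =
  m , (attained , λ H′ H′-sat → minimal (H′ , H′-sat , refl)) , minimal (H , H-sat , refl)

-- Lower bound

sole-neighbour-degree : ∀ {k} (G : OGraph k) {u v} → adj G u v ≡ true →
  (∀ w → adj G u w ≡ true → w ≡ v) → degree G u ≡ 1
sole-neighbour-degree G {u} {v} uv unique =
  trans (degree≡count G u) (count-unique (adj G u) v uv unique)

copy-uses-added-edge : ∀ {n k} {H : OGraph n} {G : OGraph k} {x y} {φ : Fin k → Fin n} →
  ¬ Contains H G → Increasing φ → Homomorphism G (addEdge H x y) φ →
  ∃₂ λ u v → adj G u v ≡ true × φ u ≡ x × φ v ≡ y
copy-uses-added-edge {H = H} {G} {x} {y} {φ} H-free φ-inc φ-hom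
  with Fin.any? (λ u → Fin.any? (λ v → (adj G u v Bool.≟ true) ×-dec (adj H (φ u) (φ v) Bool.≟ false)))
... | no none =
  contradiction (φ , φ-inc , λ u v uv → Bool.¬-not λ missing → none (u , v , uv , missing)) H-free
... | yes (u , v , uv , missing) with adj-addEdge H x y (φ u) (φ v) (φ-hom u v uv)
...   | inj₁ present                 = contradiction (trans (sym missing) present) λ ()
...   | inj₂ (inj₁ (φu≡x , φv≡y))    = u , v , uv , φu≡x , φv≡y
...   | inj₂ (inj₂ (φu≡y , φv≡x))    = v , u , trans (adj-sym G v u) uv , φv≡x , φu≡y

module _ {n k} {G : OGraph k} {H : OGraph n} {x y : Fin n} (consecutive : toℕ y ≡ suc (toℕ x))
         (x-isolated : Isolated H x) (y-isolated : Isolated H y)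
         {φ : Fin k → Fin n} (φ-inc : Increasing φ) (φ-hom : Homomorphism G (addEdge H x y) φ) where

  private
    x≢y : x ≢ y
    x≢y x≡y = 1+n≢n (trans (sym consecutive) (cong toℕ (sym x≡y)))

    addEdge-hom : ∀ {u w p} → φ u ≡ p → adj G u w ≡ true → adj (addEdge H x y) p (φ w) ≡ true
    addEdge-hom {u} {w} refl uw = φ-hom u w uw

  preimage-of-added-edge-is-minedge : ∀ {u v} → adj G u v ≡ true → φ u ≡ x → φ v ≡ y → IsMinedge G u v
  preimage-of-added-edge-is-minedge {u} {v} uv φu≡x φv≡y =
    v≡1+u , trans (sym (adj-< G u v (≤-reflexive (sym v≡1+u)))) uv , degree-u , degree-v
    where
    v≡1+u : toℕ v ≡ suc (toℕ u)
    v≡1+u = Increasing-reflects-consecutive φ-inc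
      (subst₂ (λ p q → toℕ q ≡ suc (toℕ p)) (sym φu≡x) (sym φv≡y) consecutive)
    degree-u : degree G u ≡ 1
    degree-u = sole-neighbour-degree G uv λ w uw →
      Sum.[ (λ (_ , φw≡y) → Increasing-injective φ-inc (trans φw≡y (sym φv≡y)))
          , (λ (x≡y , _) → contradiction x≡y x≢y)
          ]′ (isolated-addEdge H x y x-isolated (addEdge-hom φu≡x uw))
    degree-v : degree G v ≡ 1
    degree-v = sole-neighbour-degree G (trans (adj-sym G v u) uv) λ w vw →
      Sum.[ (λ (y≡x , _) → contradiction (sym y≡x) x≢y)
          , (λ (_ , φw≡x) → Increasing-injective φ-inc (trans φw≡x (sym φu≡x)))
          ]′ (isolated-addEdge H x y y-isolated (addEdge-hom φv≡y vw))

module _ {n k} {G : OGraph k} (no-minedge : ∀ u v → ¬ IsMinedge G u v)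
         {H : OGraph n} (H-sat : Saturates H G) where

  no-consecutive-isolated-pair : ∀ {x y} → toℕ y ≡ suc (toℕ x) → Isolated H x → Isolated H y → ⊥
  no-consecutive-isolated-pair {x} {y} consecutive x-isolated y-isolated
    with H-sat .proj₂ x y x<y (trans (sym (adj-< H x y x<y)) (x-isolated y))
    where
    x<y : toℕ x < toℕ y
    x<y = ≤-reflexive (sym consecutive)
  ... | φ , φ-inc , φ-hom with copy-uses-added-edge {H = H} (H-sat .proj₁) φ-inc φ-hom
  ...   | u , v , uv , φu≡x , φv≡y = no-minedge u v
    (preimage-of-added-edge-is-minedge consecutive x-isolated y-isolated φ-inc φ-hom uv φu≡x φv≡y)

  consecutive-degrees-positive : ∀ x y → toℕ y ≡ suc (toℕ x) → 1 ≤ degree H x + degree H y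
  consecutive-degrees-positive x y consecutive with degree H x in dx | degree H y in dy
  ... | suc _ | _     = s≤s z≤n
  ... | zero  | suc _ = s≤s z≤n
  ... | zero  | zero  = ⊥-elim (no-consecutive-isolated-pair consecutive
                          (degree≡0⇒isolated H x dx) (degree≡0⇒isolated H y dy))

  n≤4*edges+1 : n ≤ 4 * edges H + 1
  n≤4*edges+1 = begin
    n                             ≤⟨ n≤2*sum+1 n (degree H) consecutive-degrees-positive ⟩
    2 * ∑[ x < n ] degree H x + 1 ≤⟨ +-monoˡ-≤ 1 (*-monoʳ-≤ 2 (∑degree≤2*edges H)) ⟩
    2 * (2 * edges H) + 1         ≡⟨ cong (_+ 1) (*-assoc 2 2 (edges H)) ⟨
    4 * edges H + 1               ∎
    where open ≤-Reasoning

-- Upper bound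

increasing-enumeration : ∀ {n} (b : Fin n → Bool) {L} → L ≤ count b →
  Σ (Fin L → Fin n) λ ψ → Increasing ψ × (∀ t → b (ψ t) ≡ true)
increasing-enumeration b {zero} _ = (λ ()) , (λ ()) , λ ()
increasing-enumeration {suc n} b {suc L} L<count with b zero in b₀
... | true with increasing-enumeration (b ∘ suc) (s≤s⁻¹ L<count)
...   | ψ , ψ-inc , ψ-true = zero ∷ suc ∘ ψ , inc , true′
  where
  inc : Increasing (zero ∷ suc ∘ ψ)
  inc zero    (suc t) _   = z<s
  inc (suc s) (suc t) s<t = s<s (ψ-inc s t (s<s⁻¹ s<t))
  true′ : ∀ t → b ((zero ∷ suc ∘ ψ) t) ≡ true
  true′ zero    = b₀
  true′ (suc t) = ψ-true t
increasing-enumeration {suc n} b {suc L} L<count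
  | false with increasing-enumeration (b ∘ suc) L<count
...   | ψ , ψ-inc , ψ-true = suc ∘ ψ , (λ s t → s<s ∘ ψ-inc s t) , ψ-true

∧-true : ∀ {b c} → (b ∧ c) ≡ true → b ≡ true × c ≡ true
∧-true {true} c≡true = refl , c≡true

last-left-endpoint : ∀ {k} (G : OGraph k) → HasEdge G →
  ∃[ a ] HasRightNeighbour G a × (∀ u → toℕ a < toℕ u → ¬ HasRightNeighbour G u)
last-left-endpoint G = greatest-Fin λ u → Fin.any? λ v → (toℕ u <? toℕ v) ×-dec (G u v Bool.≟ true)

prefixJoin : ∀ {n} → ℕ → OGraph n
prefixJoin A i j = toℕ i <ᵇ A

module PrefixJoin {k} (G : OGraph k) (a : Fin k) (a-left : HasRightNeighbour G a)
                  (a-last : ∀ u → toℕ a < toℕ u → ¬ HasRightNeighbour G u) where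

  A L : ℕ
  A = toℕ a
  L = k ∸ suc A

  prefixJoin-free : ∀ {n} → ¬ Contains (prefixJoin {n} A) G
  prefixJoin-free (φ , φ-inc , φ-hom) = image-of-a a-left
    where
    image-of-a : HasRightNeighbour G a → ⊥
    image-of-a (b , a<b , ab) = <⇒≱ (<ᵇ≡true⇒< image-edge) (Increasing-≥ φ-inc a)
      where
      image-edge : prefixJoin A (φ a) (φ b) ≡ true
      image-edge = trans (sym (adj-< (prefixJoin A) (φ a) (φ b) (φ-inc a b a<b)))
                         (φ-hom a b (trans (adj-< G a b a<b) ab))

  -- Position of u counted from a; junk value 0 for the vertices before a.
  offset : Fin k → Fin (suc L)
  offset u = fromℕ< (s≤s (∸-monoˡ-≤ (suc A) (Fin.toℕ<n u)))

  toℕ-offset : ∀ u → toℕ (offset u) ≡ toℕ u ∸ A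
  toℕ-offset u = Fin.toℕ-fromℕ< _

  module Embedding {n} {H : OGraph n} (base⊆H : prefixJoin A ⊆ H) {x : Fin n} (A≤x : A ≤ toℕ x)
                   {ψ : Fin L → Fin n} (ψ-inc : Increasing ψ)
                   (ψ-right : ∀ t → toℕ x < toℕ (ψ t) × H x (ψ t) ≡ true) where

    ψ⁺ : Fin (suc L) → Fin n
    ψ⁺ = x ∷ ψ

    x≤ψ⁺ : ∀ t → toℕ x ≤ toℕ (ψ⁺ t)
    x≤ψ⁺ zero    = ≤-refl
    x≤ψ⁺ (suc t) = <⇒≤ (ψ-right t .proj₁)

    ψ⁺-inc : Increasing ψ⁺
    ψ⁺-inc zero    (suc t) _   = ψ-right t .proj₁
    ψ⁺-inc (suc s) (suc t) s<t = ψ-inc s t (s<s⁻¹ s<t)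

    ψ⁺-edge : ∀ s t → toℕ s ≡ 0 → 0 < toℕ t → H (ψ⁺ s) (ψ⁺ t) ≡ true
    ψ⁺-edge zero (suc t) _ _ = ψ-right t .proj₂

    -- Fix the vertices before a, send a to x and the vertices after a to the neighbours ψ of x.
    φ : Fin k → Fin n
    φ u with toℕ u <? A
    ... | yes u<A = fromℕ< (<-trans (<-≤-trans u<A A≤x) (Fin.toℕ<n x))
    ... | no  _   = ψ⁺ (offset u)

    φ-below : ∀ {u} → toℕ u < A → toℕ (φ u) ≡ toℕ u
    φ-below {u} u<A with toℕ u <? A
    ... | yes _   = Fin.toℕ-fromℕ< _
    ... | no  u≮A = contradiction u<A u≮A

    φ-above : ∀ {u} → A ≤ toℕ u → φ u ≡ ψ⁺ (offset u)
    φ-above {u} A≤u with toℕ u <? A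
    ... | yes u<A = contradiction A≤u (<⇒≱ u<A)
    ... | no  _   = refl

    φ-inc : Increasing φ
    φ-inc u v u<v = by-position (toℕ u <? A) (toℕ v <? A)
      where
      by-position : Dec (toℕ u < A) → Dec (toℕ v < A) → toℕ (φ u) < toℕ (φ v)
      by-position (yes u<A) (yes v<A) = subst₂ _<_ (sym (φ-below u<A)) (sym (φ-below v<A)) u<v
      by-position (yes u<A) (no  v≮A) = begin-strict
        toℕ (φ u)                ≡⟨ φ-below u<A ⟩
        toℕ u                    <⟨ <-≤-trans u<A A≤x ⟩
        toℕ x                    ≤⟨ x≤ψ⁺ (offset v) ⟩
        toℕ (ψ⁺ (offset v))      ≡⟨ cong toℕ (φ-above (≮⇒≥ v≮A)) ⟨
        toℕ (φ v)                ∎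
        where open ≤-Reasoning
      by-position (no  u≮A) (yes v<A) = contradiction (<-trans u<v v<A) u≮A
      by-position (no  u≮A) (no  v≮A) =
        subst₂ (λ p q → toℕ p < toℕ q) (sym (φ-above (≮⇒≥ u≮A))) (sym (φ-above (≮⇒≥ v≮A)))
          (ψ⁺-inc (offset u) (offset v)
            (subst₂ _<_ (sym (toℕ-offset u)) (sym (toℕ-offset v)) (∸-monoˡ-< u<v (≮⇒≥ u≮A))))

    φ-forward : ∀ u v → toℕ u < toℕ v → G u v ≡ true → H (φ u) (φ v) ≡ true
    φ-forward u v u<v uv = by-position (toℕ u <? A)
      where
      by-position : Dec (toℕ u < A) → H (φ u) (φ v) ≡ true
      by-position (yes u<A) =
        base⊆H (φ u) (φ v) (φ-inc u v u<v) (<⇒<ᵇ≡true (subst (_< A) (sym (φ-below u<A)) u<A))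
      by-position (no u≮A) = subst₂ (λ p q → H p q ≡ true) (sym (φ-above A≤u)) (sym (φ-above A≤v))
        (ψ⁺-edge (offset u) (offset v) offset-u≡0 (subst (0 <_) (sym (toℕ-offset v)) (m<n⇒0<n∸m A<v)))
        where
        A≡u : A ≡ toℕ u
        A≡u = ≤∧≮⇒≡ (≮⇒≥ u≮A) (λ A<u → a-last u A<u (v , u<v , uv))
        A≤u : A ≤ toℕ u
        A≤u = ≤-reflexive A≡u
        A<v : A < toℕ v
        A<v = subst (_< toℕ v) (sym A≡u) u<v
        A≤v : A ≤ toℕ v
        A≤v = <⇒≤ A<v
        offset-u≡0 : toℕ (offset u) ≡ 0
        offset-u≡0 = trans (toℕ-offset u) (trans (cong (_∸ A) (sym A≡u)) (n∸n≡0 A))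

    contains : Contains H G
    contains = φ , φ-inc , homomorphism-from-< {H = H} φ-inc φ-forward

  module _ {n} {H : OGraph n} (base⊆H : prefixJoin A ⊆ H) (H-free : ¬ Contains H G) where

    rightDegree<L : ∀ x → A ≤ toℕ x → rightDegree H x < L
    rightDegree<L x A≤x = ≰⇒> λ L≤rightDegree →
      let ψ , ψ-inc , ψ-true = increasing-enumeration (λ j → (toℕ x <ᵇ toℕ j) ∧ H x j) L≤rightDegree
      in H-free (Embedding.contains base⊆H A≤x ψ-inc
                   (λ t → let x<ψt , Hxψt = ∧-true (ψ-true t) in <ᵇ≡true⇒< x<ψt , Hxψt))

    edges≤A*n+n*L : edges H ≤ A * n + n * L
    edges≤A*n+n*L = subst (_≤ A * n + n * L) (sym (edges≡∑rightDegree H))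
      (sum-≤-split A (λ i _ → count-≤ _) (λ i A≤i → <⇒≤ (rightDegree<L i A≤i)))

    edges≤2*k*n : edges H ≤ 2 * k * n
    edges≤2*k*n = begin
      edges H            ≤⟨ edges≤A*n+n*L ⟩
      A * n + n * L      ≤⟨ +-mono-≤ (*-monoˡ-≤ n (<⇒≤ (Fin.toℕ<n a))) (*-monoʳ-≤ n (m∸n≤m k (suc A))) ⟩
      k * n + n * k      ≡⟨ twice k n ⟩
      2 * k * n          ∎
      where
      open ≤-Reasoning
      twice : ∀ k n → k * n + n * k ≡ 2 * k * n
      twice = solve-∀

n≤4m+1⇒n≤5m : ∀ {n m} → 2 ≤ n → n ≤ 4 * m + 1 → n ≤ 5 * m
n≤4m+1⇒n≤5m {m = zero}  2≤n n≤1 = contradiction (≤-trans 2≤n n≤1) λ { (s≤s ()) }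
n≤4m+1⇒n≤5m {m = suc m} _   n≤4m+1 =
  ≤-trans n≤4m+1 (≤-trans (+-monoʳ-≤ (4 * suc m) (s≤s z≤n)) (≤-reflexive (+-comm (4 * suc m) (suc m))))

claim1 : ∀ {k} (G : OGraph k) → HasEdge G → (∀ u v → ¬ IsMinedge G u v) →
    ∃[ c ] ∃[ C ] ∃[ N ] (∀ n → n ≥ N →
    Σ ℕ λ m → IsSat n G m × n ≤ c * m × m ≤ C * n)
claim1 {k} G has-edge no-minedge with last-left-endpoint G has-edge
... | a , a-left , a-last = 5 , 2 * k , 2 , bounds
  where
  open PrefixJoin G a a-left a-last
  bounds : ∀ n → n ≥ 2 → Σ ℕ λ m → IsSat n G m × n ≤ 5 * m × m ≤ 2 * k * n
  bounds n n≥2 with saturating-extension (prefixJoin-free {n})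
  ... | H , base⊆H , H-sat with sat-attained H-sat
  ...   | m , m-sat@((Hmin , Hmin-sat , refl) , _) , m≤edges = m , m-sat , lower , upper
    where
    lower : n ≤ 5 * m
    lower = n≤4m+1⇒n≤5m {m = m} n≥2 (n≤4*edges+1 no-minedge Hmin-sat)
    upper : m ≤ 2 * k * n
    upper = ≤-trans m≤edges (edges≤2*k*n base⊆H (H-sat .proj₁))
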